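{- Let $V$ be a finite-dimensional $\mathbb{F}_2$-vector space with a nondegenerate symplectic form $B$. Let $P$ be a basis of $V$ such that the graph $G(P)$ is a tree but not a path. Then $P$ is of orthogonal type.
   Context: For $\alpha\in V$, the transvection $\tau_\alpha:V\to V$ is defined by $\tau_\alpha\beta=\beta+B(\beta,\alpha)\alpha$. For a subset $P\subseteq V$, $G(P)$ is the simple graph with vertex set $P$ in which $\alpha,\beta\in P$ are adjacent iff $B(\alpha,\beta)=1$. For linearly independent sets $P,P'$, $P'$ is elementary $t$-equivalent to $P$ if there are $\alpha,\beta\in P$ such that $P'$ is obtained from $P$ by replacing $\beta$ with $\tau_\alpha\beta$. The $t$-equivalence relation is the equivalence relation generated by elementary $t$-equivalence. A basis $P$ of $V$ has orthogonal type if $P$ is $t$-equivalent to some $P'$ such that $G(P')$ is a tree containing as a subgraph the tree on six vertices $v_1,\dots,v_6$ with edges $v_1v_2, v_2v_3, v_3v_4, v_4v_5, v_3v_6$ (a path of five vertices with a pendant vertex attached to the middle one). -}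

module Defs where

open import Data.Nat using (ℕ; zero; suc)
open import Data.Bool using (Bool; true; false; _xor_; if_then_else_)
open import Data.Fin using (Fin; zero; suc; toℕ; inject₁; fromℕ)
open import Data.Vec using (Vec; zipWith; replicate; tabulate; foldr′)
open import Data.Product using (Σ; ∃; ∃-syntax; _×_; _,_)
open import Data.Sum using (_⊎_)
open import Relation.Nullary using (¬_)
open import Relation.Binary.PropositionalEquality using (_≡_; _≢_)
open import Relation.Binary.Construct.Closure.ReflexiveTransitive using (Star)
open import Relation.Binary.Construct.Closure.Equivalence using (EqClosure)
open import Function.Definitions using (Injective)
open import Function.Bundles using (_⇔_)

-- The finite-dimensional F₂-vector space, realised as F₂ⁿ (Bool = F₂, xor = +).
V : ℕ → Set
V n = Vec Bool n

_⊕_ : ∀ {n} → V n → V n → V n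
_⊕_ = zipWith _xor_

𝟎 : ∀ {n} → V n
𝟎 = replicate _ false

-- A nondegenerate symplectic (= alternating bilinear) form on F₂ⁿ.
-- Over F₂ bilinearity is biadditivity.
record SymplecticForm (n : ℕ) : Set where
  field
    B             : V n → V n → Bool
    additiveˡ     : ∀ x y z → B (x ⊕ y) z ≡ (B x z xor B y z)
    additiveʳ     : ∀ x y z → B x (y ⊕ z) ≡ (B x y xor B x z)
    alternating   : ∀ x → B x x ≡ false
    nondegenerate : ∀ x → (∀ y → B x y ≡ false) → x ≡ 𝟎

Family : ℕ → Set
Family n = Fin n → V n

lincomb : ∀ {n} → (Fin n → Bool) → Family n → V n
lincomb {n} c P = foldr′ _⊕_ 𝟎 (tabulate λ i → if c i then P i else 𝟎)

LinearlyIndependent : ∀ {n} → Family n → Set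
LinearlyIndependent P = ∀ c → lincomb c P ≡ 𝟎 → ∀ i → c i ≡ false

Spanning : ∀ {n} → Family n → Set
Spanning P = ∀ v → ∃[ c ] lincomb c P ≡ v

IsBasis : ∀ {n} → Family n → Set
IsBasis P = LinearlyIndependent P × Spanning P

module _ {n : ℕ} (S : SymplecticForm n) where
  open SymplecticForm S

  τ : V n → V n → V n
  τ α β = if B β α then β ⊕ α else β

  Adj : Family n → Fin n → Fin n → Set
  Adj P i j = B (P i) (P j) ≡ true

  Connected : Family n → Set
  Connected P = ∀ i j → Star (Adj P) i j

  HasCycle : Family n → Set
  HasCycle P = ∃[ k ] Σ (Fin (suc (suc (suc k))) → Fin n) λ c →
      Injective _≡_ _≡_ c
    × (∀ (m : Fin (suc (suc k))) → Adj P (c (inject₁ m)) (c (suc m)))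
    × Adj P (c (fromℕ (suc (suc k)))) (c zero)

  IsTree : Family n → Set
  IsTree P = Connected P × ¬ HasCycle P

  IsPath : Family n → Set
  IsPath P = Σ (Fin n → Fin n) λ σ → Injective _≡_ _≡_ σ ×
    (∀ a b → Adj P (σ a) (σ b) ⇔ (suc (toℕ a) ≡ toℕ b ⊎ suc (toℕ b) ≡ toℕ a))

  ElemTEquiv : Family n → Family n → Set
  ElemTEquiv P P' = ∃[ i ] ∃[ j ]
      P' j ≡ τ (P i) (P j) × (∀ k → k ≢ j → P' k ≡ P k)

  TEquiv : Family n → Family n → Set
  TEquiv = EqClosure ElemTEquiv

  -- G(P) contains the tree v1-v2-v3-v4-v5 with v6 pendant at v3
  -- (vertices indexed 0..5 here).
  ContainsE6 : Family n → Set
  ContainsE6 P = Σ (Fin 6 → Fin n) λ f → Injective _≡_ _≡_ f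
    × Adj P (f (# 0)) (f (# 1)) × Adj P (f (# 1)) (f (# 2))
    × Adj P (f (# 2)) (f (# 3)) × Adj P (f (# 3)) (f (# 4))
    × Adj P (f (# 2)) (f (# 5))
    where open import Data.Fin using (#_)

  OrthogonalType : Family n → Set
  OrthogonalType P = ∃[ P' ] TEquiv P P' × IsTree P' × ContainsE6 P'

module Submission where

-- G(P) itself has orthogonal type. A tree that is not a path has a vertex v with three
-- distinct neighbours (a claw): a claw-free tree is a path, obtained by growing a maximal
-- path from a leaf. If two neighbours x, y of v were both leaves, P x and P y would pair
-- identically with every basis vector (nontrivially only with P v), so P x + P y would be
-- orthogonal to all of V, hence zero by nondegeneracy, contradicting linear independence.
-- So two of the three neighbours of v have a further neighbour, and together with v and
-- the third neighbour they span the required six-vertex subtree; acyclicity keeps the six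
-- vertices distinct.

open import Defs
open import Algebra.Bundles using (CommutativeSemigroup)
import Algebra.Properties.CommutativeSemigroup as CommutativeSemigroupProperties
open import Data.Bool using (Bool; true; false; _xor_; if_then_else_)
open import Data.Bool.Properties
  using (¬-not; xor-same; xor-assoc; xor-comm; xor-identityˡ; xor-identityʳ)
  renaming (_≟_ to _≟ᵇ_)
open import Data.Empty using (⊥; ⊥-elim)
open import Data.Fin using (Fin; zero; suc; inject₁; fromℕ; toℕ)
open import Data.Fin.Properties
  using (_≟_; suc-injective; any?; toℕ-inject₁; toℕ-injective; <⇒notInjective; cantor-schröder-bernstein)
open import Data.Nat using (ℕ; zero; suc; _+_; s≤s)
import Data.Nat.Properties as ℕ
open import Data.Sum as Sum using (_⊎_; inj₁; inj₂)
open import Data.Product using (Σ; _×_; _,_; ∃-syntax; proj₁; proj₂)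
open import Data.Vec using (Vec; []; _∷_; lookup; tabulate; foldr′)
open import Data.Vec.Relation.Unary.All using ([]; _∷_)
open import Data.Vec.Relation.Unary.AllPairs using ([]; _∷_)
open import Data.Vec.Relation.Unary.Unique.Propositional using (Unique)
open import Data.Vec.Relation.Unary.Unique.Propositional.Properties using (lookup-injective)
import Data.Vec.Functional as Vecᶠ
open import Data.Vec.Properties
  using (tabulate-cong; map-id; zipWith-assoc; zipWith-comm; zipWith-identityˡ;
         zipWith-identityʳ; zipWith-inverseʳ)
open import Function using (id; _∘_; _⇔_; mk⇔; Equivalence; Injective)
open import Function.Properties.Equivalence using () renaming (sym to ⇔-sym; trans to ⇔-trans)
open import Relation.Binary.PropositionalEquality
open import Relation.Binary.PropositionalEquality.Algebra using (isMagma)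
open import Relation.Binary.Construct.Closure.ReflexiveTransitive using (Star; ε; _◅_)
open import Relation.Nullary using (¬_; Dec; yes; no; does; ¬?; _×-dec_)
open import Relation.Nullary.Decidable using (dec-true; dec-false; decidable-stable)

module _ {n : ℕ} where

  ⊕-commutativeSemigroup : CommutativeSemigroup _ _
  ⊕-commutativeSemigroup = record
    { Carrier = V n
    ; _≈_     = _≡_
    ; _∙_     = _⊕_
    ; isCommutativeSemigroup = record
      { isSemigroup = record { isMagma = isMagma _⊕_ ; assoc = zipWith-assoc xor-assoc }
      ; comm        = zipWith-comm xor-comm
      }
    }

  open CommutativeSemigroupProperties ⊕-commutativeSemigroup using (interchange)

  ⊕-identityˡ : (u : V n) → 𝟎 ⊕ u ≡ u
  ⊕-identityˡ = zipWith-identityˡ xor-identityˡ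

  ⊕-identityʳ : (u : V n) → u ⊕ 𝟎 ≡ u
  ⊕-identityʳ = zipWith-identityʳ xor-identityʳ

  ⊕-self : (u : V n) → u ⊕ u ≡ 𝟎
  ⊕-self u = trans (cong (u ⊕_) (sym (map-id u))) (zipWith-inverseʳ {⁻¹ = id} xor-same u)

  ⊕≡𝟎⇒≡ : (u v : V n) → u ⊕ v ≡ 𝟎 → u ≡ v
  ⊕≡𝟎⇒≡ u v u⊕v≡𝟎 = begin
    u             ≡⟨ sym (⊕-identityʳ u) ⟩
    u ⊕ 𝟎         ≡⟨ cong (u ⊕_) (sym (⊕-self v)) ⟩
    u ⊕ (v ⊕ v)   ≡⟨ sym (zipWith-assoc xor-assoc u v v) ⟩
    (u ⊕ v) ⊕ v   ≡⟨ cong (_⊕ v) u⊕v≡𝟎 ⟩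
    𝟎 ⊕ v         ≡⟨ ⊕-identityˡ v ⟩
    v             ∎
    where open ≡-Reasoning

  ∑ : ∀ {m} → (Fin m → V n) → V n
  ∑ f = foldr′ _⊕_ 𝟎 (tabulate f)

  ∑-cong : ∀ {m} {f g : Fin m → V n} → (∀ i → f i ≡ g i) → ∑ f ≡ ∑ g
  ∑-cong f≗g = cong (foldr′ _⊕_ 𝟎) (tabulate-cong f≗g)

  ∑-zero : ∀ {m} (f : Fin m → V n) → (∀ i → f i ≡ 𝟎) → ∑ f ≡ 𝟎
  ∑-zero {zero}  f f≗𝟎 = refl
  ∑-zero {suc m} f f≗𝟎 =
    trans (cong₂ _⊕_ (f≗𝟎 zero) (∑-zero (λ i → f (suc i)) (λ i → f≗𝟎 (suc i)))) (⊕-self 𝟎)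

  ∑-single : ∀ {m} (f : Fin m → V n) x → (∀ i → i ≢ x → f i ≡ 𝟎) → ∑ f ≡ f x
  ∑-single f zero    f≗𝟎 =
    trans (cong (f zero ⊕_) (∑-zero (λ i → f (suc i)) (λ i → f≗𝟎 (suc i) λ ())))
          (⊕-identityʳ (f zero))
  ∑-single f (suc x) f≗𝟎 =
    trans (cong₂ _⊕_ (f≗𝟎 zero λ ())
                     (∑-single (λ i → f (suc i)) x λ i i≢x → f≗𝟎 (suc i) (i≢x ∘ suc-injective)))
          (⊕-identityˡ (f (suc x)))

  ∑-⊕ : ∀ {m} (f g : Fin m → V n) → ∑ (λ i → f i ⊕ g i) ≡ ∑ f ⊕ ∑ g
  ∑-⊕ {zero}  f g = sym (⊕-self 𝟎)
  ∑-⊕ {suc m} f g =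
    trans (cong ((f zero ⊕ g zero) ⊕_) (∑-⊕ (λ i → f (suc i)) (λ i → g (suc i))))
          (interchange (f zero) (g zero) _ _)

  if-xor : ∀ a b (u : V n) →
    (if a xor b then u else 𝟎) ≡ (if a then u else 𝟎) ⊕ (if b then u else 𝟎)
  if-xor true  true  u = sym (⊕-self u)
  if-xor true  false u = sym (⊕-identityʳ u)
  if-xor false true  u = sym (⊕-identityˡ u)
  if-xor false false u = sym (⊕-self 𝟎)

  lincomb-xor : ∀ (c d : Fin n → Bool) P →
    lincomb (λ i → c i xor d i) P ≡ lincomb c P ⊕ lincomb d P
  lincomb-xor c d P = trans (∑-cong λ i → if-xor (c i) (d i) (P i))
                            (∑-⊕ (λ i → if c i then P i else 𝟎) (λ i → if d i then P i else 𝟎))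

  indicator : Fin n → Fin n → Bool
  indicator x i = does (i ≟ x)

  lincomb-indicator : ∀ P x → lincomb (indicator x) P ≡ P x
  lincomb-indicator P x =
    trans (∑-single _ x λ i i≢x → cong (λ b → if b then P i else 𝟎) (dec-false (i ≟ x) i≢x))
          (cong (λ b → if b then P x else 𝟎) (dec-true (x ≟ x) refl))

  independent⇒injective : ∀ {P} → LinearlyIndependent P → ∀ {x y} → P x ≡ P y → x ≡ y
  independent⇒injective {P} independent {x} {y} Px≡Py = decidable-stable (x ≟ y) λ x≢y →
    true≢false (trans (cong₂ _xor_ (sym (dec-true (x ≟ x) refl)) (sym (dec-false (x ≟ y) x≢y)))
                      (independent c lincomb-c≡𝟎 x))
    where
    c : Fin n → Bool
    c i = indicator x i xor indicator y i
    lincomb-c≡𝟎 : lincomb c P ≡ 𝟎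
    lincomb-c≡𝟎 = begin
      lincomb c P                                     ≡⟨ lincomb-xor (indicator x) (indicator y) P ⟩
      lincomb (indicator x) P ⊕ lincomb (indicator y) P ≡⟨ cong₂ _⊕_ (lincomb-indicator P x) (lincomb-indicator P y) ⟩
      P x ⊕ P y                                       ≡⟨ cong (_⊕ P y) Px≡Py ⟩
      P y ⊕ P y                                       ≡⟨ ⊕-self (P y) ⟩
      𝟎                                               ∎
      where open ≡-Reasoning
    true≢false : true ≢ false
    true≢false ()

module Form {n : ℕ} (S : SymplecticForm n) where
  open SymplecticForm S

  B-zeroʳ : ∀ w → B w 𝟎 ≡ false
  B-zeroʳ w = begin
    B w 𝟎                 ≡⟨ cong (B w) (sym (⊕-self 𝟎)) ⟩
    B w (𝟎 ⊕ 𝟎)           ≡⟨ additiveʳ w 𝟎 𝟎 ⟩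
    (B w 𝟎 xor B w 𝟎)     ≡⟨ xor-same (B w 𝟎) ⟩
    false                 ∎
    where open ≡-Reasoning

  B-sym : ∀ x y → B x y ≡ B y x
  B-sym x y = begin
    B x y                               ≡⟨ sym (xor-identityʳ (B x y)) ⟩
    (B x y xor false)                   ≡⟨ cong (B x y xor_) (sym (xor-same (B y x))) ⟩
    (B x y xor (B y x xor B y x))       ≡⟨ sym (xor-assoc (B x y) (B y x) (B y x)) ⟩
    ((B x y xor B y x) xor B y x)       ≡⟨ cong (_xor B y x) Bxy⊕Byx≡false ⟩
    B y x                               ∎
    where
    open ≡-Reasoning
    Bxy⊕Byx≡false : (B x y xor B y x) ≡ false
    Bxy⊕Byx≡false = begin
      (B x y xor B y x)                                   ≡⟨ cong (B x y xor_) (xor-identityʳ (B y x)) ⟨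
      (B x y xor (B y x xor false))                       ≡⟨ cong₂ (λ a b → (a xor B x y) xor (B y x xor b)) (alternating x) (alternating y) ⟨
      ((B x x xor B x y) xor (B y x xor B y y))           ≡⟨ cong₂ _xor_ (additiveʳ x x y) (additiveʳ y x y) ⟨
      (B x (x ⊕ y) xor B y (x ⊕ y))                       ≡⟨ additiveˡ x y (x ⊕ y) ⟨
      B (x ⊕ y) (x ⊕ y)                                   ≡⟨ alternating (x ⊕ y) ⟩
      false                                               ∎

  B-∑ : ∀ {m} w (f : Fin m → V n) → (∀ i → B w (f i) ≡ false) → B w (∑ f) ≡ false
  B-∑ {zero}  w f w⊥f = B-zeroʳ w
  B-∑ {suc m} w f w⊥f = trans (additiveʳ w (f zero) (∑ λ i → f (suc i)))
    (cong₂ _xor_ (w⊥f zero) (B-∑ w (λ i → f (suc i)) (λ i → w⊥f (suc i))))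

  orthogonal-to-spanning⇒𝟎 : ∀ {P} → Spanning P → ∀ w → (∀ k → B w (P k) ≡ false) → w ≡ 𝟎
  orthogonal-to-spanning⇒𝟎 {P} spanning w w⊥P = nondegenerate w λ y →
    let (c , lincomb≡y) = spanning y
    in subst (λ v → B w v ≡ false) lincomb≡y (B-∑ w _ λ i → w⊥term (c i) i)
    where
    w⊥term : ∀ b i → B w (if b then P i else 𝟎) ≡ false
    w⊥term true  i = w⊥P i
    w⊥term false i = B-zeroʳ w

  basis-separates : ∀ {P} → IsBasis P → ∀ {x y} →
    (∀ k → B (P x) (P k) ≡ B (P y) (P k)) → x ≡ y
  basis-separates {P} (independent , spanning) {x} {y} same =
    independent⇒injective independent
      (⊕≡𝟎⇒≡ (P x) (P y) (orthogonal-to-spanning⇒𝟎 spanning (P x ⊕ P y) λ k →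
        trans (additiveˡ (P x) (P y) (P k))
              (trans (cong (_xor B (P y) (P k)) (same k)) (xor-same (B (P y) (P k))))))

module Graph {n : ℕ} (S : SymplecticForm n) (P : Family n) where
  open SymplecticForm S
  open Form S

  infix 4 _~_
  _~_ : Fin n → Fin n → Set
  _~_ = Adj S P

  adj? : ∀ i j → Dec (i ~ j)
  adj? i j = B (P i) (P j) ≟ᵇ true

  adj-sym : ∀ {i j} → i ~ j → j ~ i
  adj-sym {i} {j} i~j = trans (B-sym (P j) (P i)) i~j

  adj⇒≢ : ∀ {i j} → i ~ j → i ≢ j
  adj⇒≢ {i} i~j refl with () ← trans (sym (alternating (P i))) i~j

  module _ (acyclic : ¬ HasCycle S P) where

    no-triangle : ∀ {a b c} → a ~ b → b ~ c → c ~ a → ⊥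
    no-triangle {a} {b} {c} a~b b~c c~a =
      acyclic (0 , lookup (a ∷ b ∷ c ∷ []) , (λ {i} {j} → lookup-injective distinct i j) , walk , c~a)
      where
      distinct : Unique (a ∷ b ∷ c ∷ [])
      distinct = (adj⇒≢ a~b ∷ adj⇒≢ (adj-sym c~a) ∷ []) ∷ (adj⇒≢ b~c ∷ []) ∷ [] ∷ []
      walk : ∀ m → lookup (a ∷ b ∷ c ∷ []) (inject₁ m) ~ lookup (a ∷ b ∷ c ∷ []) (suc m)
      walk zero       = a~b
      walk (suc zero) = b~c

    no-square : ∀ {a b c d} → a ≢ c → b ≢ d → a ~ b → b ~ c → c ~ d → d ~ a → ⊥
    no-square {a} {b} {c} {d} a≢c b≢d a~b b~c c~d d~a =
      acyclic (1 , lookup (a ∷ b ∷ c ∷ d ∷ []) , (λ {i} {j} → lookup-injective distinct i j) , walk , d~a)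
      where
      distinct : Unique (a ∷ b ∷ c ∷ d ∷ [])
      distinct = (adj⇒≢ a~b ∷ a≢c ∷ adj⇒≢ (adj-sym d~a) ∷ [])
               ∷ (adj⇒≢ b~c ∷ b≢d ∷ [])
               ∷ (adj⇒≢ c~d ∷ [])
               ∷ [] ∷ []
      walk : ∀ m → lookup (a ∷ b ∷ c ∷ d ∷ []) (inject₁ m) ~ lookup (a ∷ b ∷ c ∷ d ∷ []) (suc m)
      walk zero             = a~b
      walk (suc zero)       = b~c
      walk (suc (suc zero)) = c~d

  Claw : Fin n → Fin n → Fin n → Fin n → Set
  Claw v a b c = v ~ a × v ~ b × v ~ c × a ≢ b × a ≢ c × b ≢ c

  HasClaw : Set
  HasClaw = ∃[ v ] ∃[ a ] ∃[ b ] ∃[ c ] Claw v a b c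

  hasClaw? : Dec HasClaw
  hasClaw? = any? λ v → any? λ a → any? λ b → any? λ c →
    adj? v a ×-dec adj? v b ×-dec adj? v c ×-dec ¬? (a ≟ b) ×-dec ¬? (a ≟ c) ×-dec ¬? (b ≟ c)

  claw-swap : ∀ {v a b c} → Claw v a b c → Claw v a c b
  claw-swap (v~a , v~b , v~c , a≢b , a≢c , b≢c) = v~a , v~c , v~b , a≢c , a≢b , b≢c ∘ sym

  claw-rotate : ∀ {v a b c} → Claw v a b c → Claw v b c a
  claw-rotate (v~a , v~b , v~c , a≢b , a≢c , b≢c) = v~b , v~c , v~a , b≢c , a≢b ∘ sym , a≢c ∘ sym

  LongArm : Fin n → Fin n → Set
  LongArm v x = ∃[ x' ] x ~ x' × x' ≢ v

  longArm? : ∀ v x → Dec (LongArm v x)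
  longArm? v x = any? λ x' → adj? x x' ×-dec ¬? (x' ≟ v)

  pendant-row : ∀ {v x} → v ~ x → ¬ LongArm v x → ∀ k → B (P x) (P k) ≡ does (k ≟ v)
  pendant-row {v} v~x short k with k ≟ v
  ... | yes refl = adj-sym v~x
  ... | no k≢v   = ¬-not λ x~k → short (k , x~k , k≢v)

  pendants-coincide : IsBasis P → ∀ {v x y} → v ~ x → v ~ y → ¬ LongArm v x → ¬ LongArm v y → x ≡ y
  pendants-coincide basis v~x v~y short-x short-y =
    basis-separates basis λ k → trans (pendant-row v~x short-x k) (sym (pendant-row v~y short-y k))

  claw-with-two-long-arms⇒E6 : ¬ HasCycle S P → ∀ {v x y z} →
    Claw v x y z → LongArm v x → LongArm v y → ContainsE6 S P
  claw-with-two-long-arms⇒E6 acyclic {v} {x} {y} {z}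
    (v~x , v~y , v~z , x≢y , x≢z , y≢z) (x' , x~x' , x'≢v) (y' , y~y' , y'≢v) =
    lookup vertices , (λ {i} {j} → lookup-injective distinct i j) ,
    adj-sym x~x' , adj-sym v~x , v~y , y~y' , v~z
    where
    vertices : Vec (Fin n) 6
    vertices = x' ∷ x ∷ v ∷ y ∷ y' ∷ z ∷ []
    x'≢y : x' ≢ y
    x'≢y x'≡y = no-triangle acyclic v~x (subst (x ~_) x'≡y x~x') (adj-sym v~y)
    x'≢y' : x' ≢ y'
    x'≢y' x'≡y' = no-square acyclic (x'≢v ∘ sym) x≢y v~x x~x'
      (adj-sym (subst (y ~_) (sym x'≡y') y~y')) (adj-sym v~y)
    x'≢z : x' ≢ z
    x'≢z x'≡z = no-triangle acyclic v~x (subst (x ~_) x'≡z x~x') (adj-sym v~z)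
    x≢y' : x ≢ y'
    x≢y' x≡y' = no-triangle acyclic v~y (subst (y ~_) (sym x≡y') y~y') (adj-sym v~x)
    y'≢z : y' ≢ z
    y'≢z y'≡z = no-triangle acyclic v~y (subst (y ~_) y'≡z y~y') (adj-sym v~z)
    distinct : Unique vertices
    distinct = (adj⇒≢ x~x' ∘ sym ∷ x'≢v ∷ x'≢y ∷ x'≢y' ∷ x'≢z ∷ [])
             ∷ (adj⇒≢ v~x ∘ sym ∷ x≢y ∷ x≢y' ∷ x≢z ∷ [])
             ∷ (adj⇒≢ v~y ∷ y'≢v ∘ sym ∷ adj⇒≢ v~z ∷ [])
             ∷ (adj⇒≢ y~y' ∷ y≢z ∷ [])
             ∷ (y'≢z ∷ [])
             ∷ [] ∷ []

  claw⇒E6 : IsBasis P → ¬ HasCycle S P → ∀ {v a b c} → Claw v a b c → ContainsE6 S P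
  claw⇒E6 basis acyclic {v} {a} {b} {c} claw@(v~a , v~b , v~c , a≢b , a≢c , b≢c)
    with longArm? v a | longArm? v b | longArm? v c
  ... | yes a-arm | yes b-arm | _        = claw-with-two-long-arms⇒E6 acyclic claw a-arm b-arm
  ... | yes a-arm | no _      | yes c-arm = claw-with-two-long-arms⇒E6 acyclic (claw-swap claw) a-arm c-arm
  ... | no _      | yes b-arm | yes c-arm = claw-with-two-long-arms⇒E6 acyclic (claw-rotate claw) b-arm c-arm
  ... | yes _     | no short-b | no short-c = ⊥-elim (b≢c (pendants-coincide basis v~b v~c short-b short-c))
  ... | no short-a | yes _    | no short-c = ⊥-elim (a≢c (pendants-coincide basis v~a v~c short-a short-c))
  ... | no short-a | no short-b | _        = ⊥-elim (a≢b (pendants-coincide basis v~a v~b short-a short-b))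

  Consecutive : ∀ {L} → Fin L → Fin L → Set
  Consecutive a b = suc (toℕ a) ≡ toℕ b ⊎ suc (toℕ b) ≡ toℕ a

  consecutive-suc : ∀ {L} {a b : Fin L} → Consecutive (suc a) (suc b) ⇔ Consecutive a b
  consecutive-suc = mk⇔ (Sum.map ℕ.suc-injective ℕ.suc-injective) (Sum.map (cong suc) (cong suc))

  InducedPath : ∀ {L} → (Fin L → Fin n) → Set
  InducedPath s = Injective _≡_ _≡_ s × (∀ a b → s a ~ s b ⇔ Consecutive a b)

  OnPath : ∀ {L} → (Fin L → Fin n) → Fin n → Set
  OnPath s w = ∃[ i ] s i ≡ w

  onPath? : ∀ {L} (s : Fin L → Fin n) w → Dec (OnPath s w)
  onPath? s w = any? λ i → s i ≟ w

  Leaf : Fin n → Set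
  Leaf r = ∀ {x y} → r ~ x → r ~ y → x ≡ y

  data Position : (k : ℕ) → Fin (suc k) → Set where
    head     : ∀ {k} → Position k zero
    last     : ∀ {k} j → Consecutive (fromℕ (suc k)) j → Position (suc k) (fromℕ (suc k))
    interior : ∀ {k i} j₁ j₂ → j₁ ≢ j₂ → Consecutive i j₁ → Consecutive i j₂ → Position k i

  position : ∀ {k} (i : Fin (suc k)) → Position k i
  position zero = head
  position {suc k} (suc i) with position i
  ... | head = second
    where
    second : ∀ {k} → Position (suc k) (suc zero)
    second {zero}  = last zero (inj₂ refl)
    second {suc k} = interior zero (suc (suc zero)) (λ ()) (inj₂ refl) (inj₁ refl)
  ... | last j c = last (suc j) (Equivalence.from consecutive-suc c)
  ... | interior j₁ j₂ j₁≢j₂ c₁ c₂ =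
    interior (suc j₁) (suc j₂) (j₁≢j₂ ∘ suc-injective)
      (Equivalence.from consecutive-suc c₁) (Equivalence.from consecutive-suc c₂)

  path-walk : ∀ {k} {s : Fin (suc k) → Fin n} → InducedPath s → ∀ m → s (inject₁ m) ~ s (suc m)
  path-walk (_ , adj⇔) m = Equivalence.from (adj⇔ (inject₁ m) (suc m)) (inj₁ (cong suc (toℕ-inject₁ m)))

  trivial-path : ∀ r → InducedPath (λ (_ : Fin 1) → r)
  trivial-path r = (λ { {zero} {zero} _ → refl }) ,
    λ { zero zero → mk⇔ (λ r~r → ⊥-elim (adj⇒≢ r~r refl)) λ { (inj₁ ()) ; (inj₂ ()) } }

  crossing : ∀ {L} (s : Fin L → Fin n) {x u} → Star _~_ x u → OnPath s x → ¬ OnPath s u →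
    ∃[ i ] ∃[ z ] ¬ OnPath s z × s i ~ z
  crossing s ε x-on u-off = ⊥-elim (u-off x-on)
  crossing s (_◅_ {j = x'} x~x' rest) (i , sᵢ≡x) u-off with onPath? s x'
  ... | yes x'-on = crossing s rest x'-on u-off
  ... | no x'-off = i , x' , x'-off , subst (_~ x') (sym sᵢ≡x) x~x'

  FrontMaximal : ∀ {k} → (Fin (suc k) → Fin n) → Set
  FrontMaximal s = ∀ {w} → s zero ~ w → OnPath s w

  record FrontMaximalPath (r : Fin n) : Set where
    field
      len           : ℕ
      vertex        : Fin (suc len) → Fin n
      induced       : InducedPath vertex
      ends-at       : vertex (fromℕ len) ≡ r
      front-maximal : FrontMaximal vertex

  neighbour-of-head : ∀ {k} {s : Fin (suc k) → Fin n} → InducedPath s → ∀ {i} → s zero ~ s i → toℕ i ≡ 1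
  neighbour-of-head (_ , adj⇔) {i} s₀~sᵢ with Equivalence.to (adj⇔ zero i) s₀~sᵢ
  ... | inj₁ 1≡i = sym 1≡i

  head-is-leaf : ∀ {k} {s : Fin (suc k) → Fin n} → InducedPath s → FrontMaximal s → Leaf (s zero)
  head-is-leaf {s = s} path front-maximal s₀~x s₀~y with front-maximal s₀~x | front-maximal s₀~y
  ... | i , refl | j , refl =
    cong s (toℕ-injective (trans (neighbour-of-head path s₀~x) (sym (neighbour-of-head path s₀~y))))

  module _ (acyclic : ¬ HasCycle S P) (claw-free : ¬ HasClaw) where

    interior-closed : ∀ {L} {s : Fin L → Fin n} {i j₁ j₂ z} → InducedPath s →
      j₁ ≢ j₂ → Consecutive i j₁ → Consecutive i j₂ → ¬ OnPath s z → ¬ (s i ~ z)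
    interior-closed {s = s} {i} {j₁} {j₂} {z} (injective , adj⇔) j₁≢j₂ c₁ c₂ z-off sᵢ~z =
      claw-free (s i , s j₁ , s j₂ , z ,
        Equivalence.from (adj⇔ i j₁) c₁ , Equivalence.from (adj⇔ i j₂) c₂ , sᵢ~z ,
        j₁≢j₂ ∘ injective , (λ e → z-off (j₁ , e)) , (λ e → z-off (j₂ , e)))

    prepend : ∀ {k} {s : Fin (suc k) → Fin n} {w} → InducedPath s → ¬ OnPath s w → s zero ~ w →
      InducedPath (w Vecᶠ.∷ s)
    prepend {k} {s} {w} path@(injective , adj⇔) w-off s₀~w = injective′ , adj⇔′
      where
      injective′ : Injective _≡_ _≡_ (w Vecᶠ.∷ s)
      injective′ {zero}  {zero}  _ = refl
      injective′ {zero}  {suc j} e = ⊥-elim (w-off (j , sym e))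
      injective′ {suc i} {zero}  e = ⊥-elim (w-off (i , e))
      injective′ {suc i} {suc j} e = cong suc (injective e)

      far : ∀ j → ¬ (s (suc j) ~ w)
      far j sⱼ~w with position (suc j)
      ... | last _ _ = acyclic (_ , w Vecᶠ.∷ s , injective′ , walk , sⱼ~w)
        where
        walk : ∀ m → (w Vecᶠ.∷ s) (inject₁ m) ~ (w Vecᶠ.∷ s) (suc m)
        walk zero    = adj-sym s₀~w
        walk (suc m) = path-walk path m
      ... | interior j₁ j₂ j₁≢j₂ c₁ c₂ = interior-closed path j₁≢j₂ c₁ c₂ w-off sⱼ~w

      adj⇔′ : ∀ a b → (w Vecᶠ.∷ s) a ~ (w Vecᶠ.∷ s) b ⇔ Consecutive a b
      adj⇔′ zero          zero          = mk⇔ (λ w~w → ⊥-elim (adj⇒≢ w~w refl)) λ { (inj₁ ()) ; (inj₂ ()) }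
      adj⇔′ zero          (suc zero)    = mk⇔ (λ _ → inj₁ refl) (λ _ → adj-sym s₀~w)
      adj⇔′ (suc zero)    zero          = mk⇔ (λ _ → inj₂ refl) (λ _ → s₀~w)
      adj⇔′ zero          (suc (suc j)) = mk⇔ (λ w~sⱼ → ⊥-elim (far j (adj-sym w~sⱼ))) λ { (inj₁ ()) ; (inj₂ ()) }
      adj⇔′ (suc (suc j)) zero          = mk⇔ (λ sⱼ~w → ⊥-elim (far j sⱼ~w)) λ { (inj₁ ()) ; (inj₂ ()) }
      adj⇔′ (suc a)       (suc b)       = ⇔-trans (adj⇔ a b) (⇔-sym consecutive-suc)

    only-head-leaves-path : ∀ {k} {s : Fin (suc k) → Fin n} {i z} → InducedPath s →
      Leaf (s (fromℕ k)) → ¬ OnPath s z → s i ~ z → i ≡ zero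
    only-head-leaves-path {i = i} path@(_ , adj⇔) last-leaf z-off sᵢ~z with position i
    ... | head = refl
    ... | last j c = ⊥-elim (z-off (j , last-leaf (Equivalence.from (adj⇔ _ j) c) sᵢ~z))
    ... | interior j₁ j₂ j₁≢j₂ c₁ c₂ = ⊥-elim (interior-closed path j₁≢j₂ c₁ c₂ z-off sᵢ~z)

    -- The path has k + 1 = n − m + 1 vertices, so the fuel m never reaches zero.
    grow : ∀ m {k} → m + k ≡ n → (s : Fin (suc k) → Fin n) → InducedPath s → FrontMaximalPath (s (fromℕ k))
    grow zero    k≡n s (injective , _) = ⊥-elim (<⇒notInjective (s≤s (ℕ.≤-reflexive (sym k≡n))) injective)
    grow (suc m) {k} m+k≡n s path with any? (λ w → adj? (s zero) w ×-dec ¬? (onPath? s w))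
    ... | yes (w , s₀~w , w-off) =
      grow m (trans (ℕ.+-suc m k) m+k≡n) (w Vecᶠ.∷ s) (prepend path w-off s₀~w)
    ... | no stuck = record
      { len = k ; vertex = s ; induced = path ; ends-at = refl
      ; front-maximal = λ {w} s₀~w → decidable-stable (onPath? s w) λ w-off → stuck (w , s₀~w , w-off)
      }

    maximal-path-from : ∀ r → FrontMaximalPath r
    maximal-path-from r = grow n (ℕ.+-identityʳ n) (λ _ → r) (trivial-path r)

    -- Grow a path from x₀ until its head r is a leaf, then grow a second path ending at r:
    -- it can only leave at its head, so it visits every vertex.
    path-from : Connected S P → Fin n → IsPath S P
    path-from connected x₀ = subst (λ L → Σ (Fin L → Fin n) InducedPath) len≡n (vertex , induced)
      where
      first : FrontMaximalPath x₀
      first = maximal-path-from x₀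
      r : Fin n
      r = FrontMaximalPath.vertex first zero
      open FrontMaximalPath (maximal-path-from r)
      last-leaf : Leaf (vertex (fromℕ len))
      last-leaf = subst Leaf (sym ends-at)
        (head-is-leaf (FrontMaximalPath.induced first) (FrontMaximalPath.front-maximal first))
      visits : ∀ u → OnPath vertex u
      visits u = decidable-stable (onPath? vertex u) λ u-off →
        let (i , z , z-off , sᵢ~z) = crossing vertex (connected r u) (fromℕ len , ends-at) u-off
        in z-off (front-maximal (subst (λ j → vertex j ~ z)
             (only-head-leaves-path induced last-leaf z-off sᵢ~z) sᵢ~z))
      len≡n : suc len ≡ n
      len≡n = cantor-schröder-bernstein {f = vertex} {g = λ u → proj₁ (visits u)} (proj₁ induced)
        λ {u} {u'} e → trans (sym (proj₂ (visits u))) (trans (cong vertex e) (proj₂ (visits u')))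

tree-without-claw⇒path : ∀ {n} (S : SymplecticForm n) (P : Family n) →
  IsTree S P → ¬ Graph.HasClaw S P → IsPath S P
tree-without-claw⇒path {zero}  S P _ _ = (λ ()) , (λ { {()} }) , λ ()
tree-without-claw⇒path {suc n} S P (connected , acyclic) claw-free =
  Graph.path-from S P acyclic claw-free connected zero

lemma4p3 : (n : ℕ) (S : SymplecticForm n) (P : Family n) →
    IsBasis P → IsTree S P → ¬ IsPath S P → OrthogonalType S P
lemma4p3 n S P basis tree not-path with Graph.hasClaw? S P
... | yes (_ , _ , _ , _ , claw) = P , ε , tree , Graph.claw⇒E6 S P basis (proj₂ tree) claw
... | no claw-free                = ⊥-elim (not-path (tree-without-claw⇒path S P tree claw-free))
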